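{- Let $\mathsf{L}$ be a description logic, $C\in\mathsf{L}$ a concept, $\mathcal{T}$ a TBox, and $\mathcal{W}$ a witness for $C$. Suppose that for every $x\in\Delta^{\mathcal{W}}$: whenever $C_1\sqsubseteq C_2\in\mathcal{T}$ then $C_1\rightarrow C_2\in\mathcal{L}^{\mathcal{W}}(x)$, and whenever $C_1\doteq C_2\in\mathcal{T}$ then $C_1\leftrightarrow C_2\in\mathcal{L}^{\mathcal{W}}(x)$. Then $\mathcal{W}$ is admissible with respect to $\mathcal{T}$.
   Context: A description logic (DL) $\mathsf{L}$ is based on infinite sets $\mathsf{NC}$ of atomic concepts and $\mathsf{NR}$ of atomic roles; $\mathsf{L}$ is identified with its set of well-formed concepts, closed under boolean operations ($\sqcap,\sqcup,\neg$) and sub-concepts. $C\rightarrow D$ abbreviates $\neg C\sqcup D$ and $C\leftrightarrow D$ abbreviates $(C\rightarrow D)\sqcap(D\rightarrow C)$. An interpretation is a pair $\mathcal{I}=(\Delta^{\mathcal{I}},\cdot^{\mathcal{I}})$ with $\Delta^{\mathcal{I}}$ non-empty and $\cdot^{\mathcal{I}}$ mapping $\mathsf{NC}$ to $2^{\Delta^{\mathcal{I}}}$ and $\mathsf{NR}$ to $2^{\Delta^{\mathcal{I}}\times\Delta^{\mathcal{I}}}$. With $\mathsf{L}$ is associated a set $\mathsf{Int}(\mathsf{L})$ of admissible interpretations, closed under isomorphism, such that for any two interpretations agreeing on $\mathsf{NR}$, one is in $\mathsf{Int}(\mathsf{L})$ iff the other is. Every $\mathcal{I}\in\mathsf{Int}(\mathsf{L})$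 extends to all concepts so that (I1) boolean combinations are interpreted as the corresponding set-theoretic boolean combinations, and (I2) $C^{\mathcal{I}}$ depends only on the interpretations of atomic concepts and roles occurring syntactically in $C$. A TBox $\mathcal{T}$ is a finite set of axioms $C_1\sqsubseteq C_2$ or $C_1\doteq C_2$; $\mathcal{I}\in\mathsf{Int}(\mathsf{L})$ is a model ($\mathcal{I}\models\mathcal{T}$) iff $C_1^{\mathcal{I}}\subseteq C_2^{\mathcal{I}}$ (resp. $C_1^{\mathcal{I}}=C_2^{\mathcal{I}}$) for each axiom. A witness for $C$ is a triple $\mathcal{W}=(\Delta^{\mathcal{W}},\cdot^{\mathcal{W}},\mathcal{L}^{\mathcal{W}})$ with $\Delta^{\mathcal{W}}$ non-empty, $\cdot^{\mathcal{W}}$ mapping $\mathsf{NR}$ to $2^{\Delta^{\mathcal{W}}\times\Delta^{\mathcal{W}}}$, $\mathcal{L}^{\mathcal{W}}:\Delta^{\mathcal{W}}\to2^{\mathsf{L}}$, such that (W1) some $x$ has $C\in\mathcal{L}^{\mathcal{W}}(x)$; (W2) some $\mathcal{I}\in\mathsf{Int}(\mathsf{L})$ stems from $\mathcal{W}$; (W3) every $\mathcal{I}\in\mathsf{Int}(\mathsf{L})$ stemming from $\mathcal{W}$ satisfies $D\in\mathcal{L}^{\mathcal{W}}(x)\Rightarrow x\in D^{\mathcal{I}}$. $\mathcal{I}$ stems from $\mathcal{W}$ if $\Delta^{\mathcal{I}}=\Delta^{\mathcal{W}}$, $\cdot^{\mathcal{I}}|_{\mathsf{NR}}=\cdot^{\mathcal{W}}$,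 and for all $A\in\mathsf{NC}$: $A\in\mathcal{L}^{\mathcal{W}}(x)\Rightarrow x\in A^{\mathcal{I}}$ and $\neg A\in\mathcal{L}^{\mathcal{W}}(x)\Rightarrow x\notin A^{\mathcal{I}}$. $\mathcal{W}$ is admissible w.r.t. $\mathcal{T}$ if some $\mathcal{I}\in\mathsf{Int}(\mathsf{L})$ stemming from $\mathcal{W}$ satisfies $\mathcal{I}\models\mathcal{T}$. -}

module Defs where

open import Data.Nat using (ℕ)
open import Data.Product using (Σ; _×_; _,_)
open import Data.Sum using (_⊎_)
open import Data.List using (List)
open import Data.List.Membership.Propositional using (_∈_)
open import Relation.Nullary using (¬_)
open import Function.Bundles using (_↔_; _↣_; _⇔_; Inverse)
open import Level using (0ℓ)

record Interp (NC NR : Set) : Set₁ where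
  field
    Δ    : Set
    pt   : Δ
    conc : NC → Δ → Set
    role : NR → Δ → Δ → Set

open Interp public

record Iso {NC NR : Set} (I J : Interp NC NR) : Set where
  field
    f        : Δ I ↔ Δ J
  open Inverse f public using (to)
  field
    conc-iso : ∀ A x → conc I A x ⇔ conc J A (to x)
    role-iso : ∀ R x y → role I R x y ⇔ role J R (to x) (to y)

-- Two interpretations agree on NR: same domain (literally) and equivalent roles.
-- We express "I and J agree on NR" as: J is obtained from I by changing conc only.
withConc : {NC NR : Set} → (I : Interp NC NR) → (NC → Δ I → Set) → Interp NC NR
withConc I c = record { Δ = Δ I ; pt = pt I ; conc = c ; role = role I }

record DL : Set₂ where
  infixr 7 _⊓_
  infixr 6 _⊔_
  field
    NC NR   : Set
    NC-inf  : ℕ ↣ NC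
    NR-inf  : ℕ ↣ NR
    Concept : Set
    atom    : NC → Concept
    _⊓_ _⊔_ : Concept → Concept → Concept
    ¬c_     : Concept → Concept
    occC    : NC → Concept → Set
    occR    : NR → Concept → Set
    occC-atom : ∀ A → occC A (atom A)
    occC-⊓  : ∀ A C D → occC A (C ⊓ D) ⇔ (occC A C ⊎ occC A D)
    occC-⊔  : ∀ A C D → occC A (C ⊔ D) ⇔ (occC A C ⊎ occC A D)
    occC-¬  : ∀ A C → occC A (¬c C) ⇔ occC A C
    occR-⊓  : ∀ R C D → occR R (C ⊓ D) ⇔ (occR R C ⊎ occR R D)
    occR-⊔  : ∀ R C D → occR R (C ⊔ D) ⇔ (occR R C ⊎ occR R D)
    occR-¬  : ∀ R C → occR R (¬c C) ⇔ occR R C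
    Adm     : Interp NC NR → Set
    Adm-iso : ∀ {I J} → Iso I J → Adm I → Adm J
    Adm-NR  : ∀ I (c : NC → Δ I → Set) → Adm I → Adm (withConc I c)
    ext     : (I : Interp NC NR) → Adm I → Concept → Δ I → Set
    ext-atom : ∀ I a A x → ext I a (atom A) x ⇔ conc I A x
    ext-⊓   : ∀ I a C D x → ext I a (C ⊓ D) x ⇔ (ext I a C x × ext I a D x)
    ext-⊔   : ∀ I a C D x → ext I a (C ⊔ D) x ⇔ (ext I a C x ⊎ ext I a D x)
    ext-¬   : ∀ I a C x → ext I a (¬c C) x ⇔ (¬ ext I a C x)
    ext-loc : ∀ I (a : Adm I) (c : NC → Δ I → Set) (a' : Adm (withConc I c)) C →
              (∀ A → occC A C → ∀ x → conc I A x ⇔ c A x) →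
              ∀ x → ext I a C x ⇔ ext (withConc I c) a' C x

  _⇒_ : Concept → Concept → Concept
  C ⇒ D = (¬c C) ⊔ D

  _⇔c_ : Concept → Concept → Concept
  C ⇔c D = (C ⇒ D) ⊓ (D ⇒ C)

  data Axiom : Set where
    _⊑_ : Concept → Concept → Axiom
    _≐_ : Concept → Concept → Axiom

  TBox : Set
  TBox = List Axiom

  SatAx : (I : Interp NC NR) → Adm I → Axiom → Set
  SatAx I a (C ⊑ D) = ∀ x → ext I a C x → ext I a D x
  SatAx I a (C ≐ D) = ∀ x → ext I a C x ⇔ ext I a D x

  Models : (I : Interp NC NR) → Adm I → TBox → Set
  Models I a T = ∀ ax → ax ∈ T → SatAx I a ax

  record Witness : Set₁ where
    field
      ΔW    : Set
      ptW   : ΔW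
      roleW : NR → ΔW → ΔW → Set
      label : ΔW → Concept → Set

  open Witness public

  -- The interpretation with domain Δ^W, roles ·^W and atomic concepts c.
  -- Every I stemming from W is (up to the literal identity of Δ and roles) of this form.
  interpOf : (W : Witness) → (NC → ΔW W → Set) → Interp NC NR
  interpOf W c = record { Δ = ΔW W ; pt = ptW W ; conc = c ; role = roleW W }

  StemsFrom : (W : Witness) → (NC → ΔW W → Set) → Set
  StemsFrom W c = ∀ A x → (label W x (atom A) → c A x) × (label W x (¬c atom A) → ¬ c A x)

  IsWitnessFor : Concept → Witness → Set₁
  IsWitnessFor C W =
    (Σ (ΔW W) λ x → label W x C)
    × (Σ (NC → ΔW W → Set) λ c → StemsFrom W c × Adm (interpOf W c))
    × (∀ c → (a : Adm (interpOf W c)) → StemsFrom W c →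
         ∀ x D → label W x D → ext (interpOf W c) a D x)

  AdmissibleWrt : Witness → TBox → Set₁
  AdmissibleWrt W T = Σ (NC → ΔW W → Set) λ c → StemsFrom W c ×
                        Σ (Adm (interpOf W c)) λ a → Models (interpOf W c) a T

{-# OPTIONS --safe #-}
module Submission where

open import Defs
open import Data.List.Membership.Propositional using (_∈_)
open import Data.Product using (_×_; _,_; proj₁; proj₂)
open import Data.Sum using (inj₁; inj₂)
open import Data.Empty using (⊥-elim)
open import Function.Bundles using (_⇔_; Equivalence; mk⇔)

-- By (W3), every concept in a label holds at its element in the admissible
-- interpretation provided by (W2); the labels contain the internalisations
-- C₁ → C₂ and C₁ ↔ C₂ of the axioms, so that interpretation satisfies each
-- axiom pointwise by (I1), i.e. it is a model of T.

module _ (L : DL) where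
  open DL L

  module _ (I : Interp NC NR) (a : Adm I) where

    ext-⇒-elim : ∀ C D x → ext I a (C ⇒ D) x → ext I a C x → ext I a D x
    ext-⇒-elim C D x C⇒D C-holds with Equivalence.to (ext-⊔ I a (¬c C) D x) C⇒D
    ... | inj₁ ¬C-holds = ⊥-elim (Equivalence.to (ext-¬ I a C x) ¬C-holds C-holds)
    ... | inj₂ D-holds  = D-holds

    ext-⇔c-elim : ∀ C D x → ext I a (C ⇔c D) x → ext I a C x ⇔ ext I a D x
    ext-⇔c-elim C D x C⇔D =
      mk⇔ (ext-⇒-elim C D x (proj₁ both)) (ext-⇒-elim D C x (proj₂ both))
      where both = Equivalence.to (ext-⊓ I a (C ⇒ D) (D ⇒ C) x) C⇔D

    models-if-internalisations-valid : (T : TBox) →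
      (∀ x C₁ C₂ → (C₁ ⊑ C₂) ∈ T → ext I a (C₁ ⇒ C₂) x) →
      (∀ x C₁ C₂ → (C₁ ≐ C₂) ∈ T → ext I a (C₁ ⇔c C₂) x) →
      Models I a T
    models-if-internalisations-valid T ⊑-valid ≐-valid (C₁ ⊑ C₂) ax∈T x =
      ext-⇒-elim C₁ C₂ x (⊑-valid x C₁ C₂ ax∈T)
    models-if-internalisations-valid T ⊑-valid ≐-valid (C₁ ≐ C₂) ax∈T x =
      ext-⇔c-elim C₁ C₂ x (≐-valid x C₁ C₂ ax∈T)

mainTheorem3 : (L : DL) → let open DL L in
    (C : Concept) (T : TBox) (W : Witness) → IsWitnessFor C W →
    (∀ x → (∀ C₁ C₂ → (C₁ ⊑ C₂) ∈ T → label W x (C₁ ⇒ C₂))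
    × (∀ C₁ C₂ → (C₁ ≐ C₂) ∈ T → label W x (C₁ ⇔c C₂))) →
    AdmissibleWrt W T
mainTheorem3 L C T W (_ , (c , stems , adm) , labels-hold) axioms-in-labels =
  c , stems , adm ,
  models-if-internalisations-valid L (interpOf W c) adm T
    (λ x C₁ C₂ ax∈T → holds x (proj₁ (axioms-in-labels x) C₁ C₂ ax∈T))
    (λ x C₁ C₂ ax∈T → holds x (proj₂ (axioms-in-labels x) C₁ C₂ ax∈T))
  where
  open DL L
  holds : ∀ x {D} → label W x D → ext (interpOf W c) adm D x
  holds x = labels-hold c adm stems x _
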